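{- Let $k$ be a positive integer and $n=2k+1$. Then $\mathrm{Det}(K(2k+1,k))=r$, where $r$ is the integer with $2^{r-1}-1<2k+1\leq 2^r-1$; that is, $\mathrm{Det}(K(n,k))=\lceil \log_2(n+1)\rceil$.
   Context: For positive integers $n,k$, the Kneser graph $K(n,k)$ has as vertices the $k$-element subsets of $[n]=\{1,\ldots,n\}$, two vertices being adjacent iff the subsets are disjoint. For a graph $G=(V,E)$, the determining number $\mathrm{Det}(G)$ is the minimum cardinality of a set $S\subseteq V$ such that the only automorphism of $G$ fixing every vertex of $S$ is the identity. -}

module Defs where

open import Data.Nat using (ℕ; _≤_)
open import Data.Fin using (Fin)
open import Data.Fin.Subset using (Subset; ∣_∣; _∩_; ⊥)
open import Data.Product using (Σ; _×_; proj₁)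
open import Data.List using (List; length)
open import Data.List.Membership.Propositional using (_∈_)
open import Function.Bundles using (Inverse; _⇔_; _↔_)
open import Relation.Binary.PropositionalEquality using (_≡_)

record Graph : Set₁ where
  field
    V   : Set
    Adj : V → V → Set

open Graph public

KneserV : ℕ → ℕ → Set
KneserV n k = Σ (Subset n) (λ s → ∣ s ∣ ≡ k)

Kneser : ℕ → ℕ → Graph
Kneser n k = record
  { V   = KneserV n k
  ; Adj = λ x y → proj₁ x ∩ proj₁ y ≡ ⊥ }

record Automorphism (G : Graph) : Set where
  field
    bij      : V G ↔ V G
  open Inverse bij public using (to)
  field
    preserve : ∀ x y → (Adj G x y ⇔ Adj G (to x) (to y))

IsDetermining : (G : Graph) → List (V G) → Set
IsDetermining G S = (φ : Automorphism G) →
  (∀ v → v ∈ S → Automorphism.to φ v ≡ v) → ∀ v → Automorphism.to φ v ≡ v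

-- Det(G) = r : some determining set has size r and every determining set has size ≥ r.
-- (Sets are represented by lists; duplicates only increase length, so the minimum is unaffected.)
DetEq : Graph → ℕ → Set
DetEq G r = (Σ (List (V G)) (λ S → IsDetermining G S × length S ≡ r))
          × (∀ S → IsDetermining G S → r ≤ length S)

-- Two adjacent vertices A, B of K(2k+1,k) are disjoint k-sets, so they miss exactly one point
-- of [2k+1], the hole of the edge AB.  Holes are visible in the graph: if PQ has hole y, then an
-- edge P'Q' also has hole y as soon as some X ≠ Q' is adjacent to P and P' and some Y ≠ P' is
-- adjacent to Q and Q' (the hole of P'Q' lies in X and in Y).  Exchanging a point of A with a
-- point of B yields such X and Y, and exchanges connect any two edges with a common hole, so an
-- automorphism maps all edges with hole x to edges with one common hole.  If the automorphism
-- fixes every vertex of S and the points have pairwise different membership patterns with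
-- respect to S, that hole is x again, and the automorphism is the identity.  Conversely two
-- points with equal patterns are exchanged by a transposition, an automorphism fixing S and
-- moving some vertex.  Hence S is determining iff it separates the 2k+1 points; this needs
-- 2^|S| ≥ 2k+1, and binary expansions achieve it with |S| = r.
module Submission where

open import Data.Bool using (Bool; true; false; not; if_then_else_)
open import Data.Bool.Properties using (not-injective)
open import Data.Fin using (Fin; zero; suc; _↑ˡ_; _↑ʳ_; splitAt; toℕ; inject≤; combine; funToFin; finToFun)
  renaming (_≟_ to _≟ᶠ_)
open import Data.Fin.Permutation as Perm using (Permutation′; _⟨$⟩ˡ_; inverseˡ; inverseʳ; transpose)
open import Data.Fin.Properties
  using ( 2↔Bool; pigeonhole; finToFun-funToFin; funToFin-finToFin; toℕ-↑ˡ; toℕ-inject≤; inject≤-injective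
        ; splitAt⁻¹-↑ˡ; splitAt⁻¹-↑ʳ)
  renaming (suc-injective to suc-injectiveᶠ)
open import Data.Fin.Subset
open import Data.Fin.Subset.Induction using (⊂-wellFounded; Acc; acc)
open import Data.Fin.Subset.Properties
open import Data.List using (List; []; _∷_; length)
import Data.List as List
open import Data.List.Membership.Propositional using () renaming (_∈_ to _∈ₗ_)
open import Data.List.Membership.Propositional.Properties using (∈-tabulate⁺)
open import Data.List.Properties using (length-tabulate)
open import Data.List.Relation.Unary.Any as Any using (here; there)
open import Data.List.Relation.Unary.Any.Properties using (lookup-index)
open import Data.Nat using (ℕ; zero; suc; _+_; _*_; _∸_; _^_; _≤_; _<_; s≤s; z<s)
open import Data.Nat.Divisibility using (_∣_; ∣1⇒≡1; ∣m+n∣m⇒∣n; m∣m*n)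
open import Data.Nat.Properties
open import Algebra.Properties.CommutativeMonoid.Sum +-0-commutativeMonoid
  using (sum-syntax; sum-cong-≗; ∑-permute)
open import Data.Product using (_×_; _,_; proj₁; proj₂; ∃)
open import Data.Sum using (_⊎_; inj₁; inj₂; [_,_]′)
open import Data.Vec using (Vec; []; _∷_; _++_; here; there; lookup; tabulate)
open import Data.Vec.Properties
  using ( lookup-++ˡ; lookup-++ʳ; lookup-map; lookup∘tabulate; tabulate∘lookup; tabulate-cong; lookup-replicate
        ; []=⇒lookup; lookup⇒[]=)
open import Defs
open import Function using (_∘_; id)
open import Function.Bundles using (Inverse; Injection; Equivalence; mk↔ₛ′; mk⇔)
open import Function.Construct.Symmetry using (↔-sym)
open import Function.Properties.Inverse using (Inverse⇒Injection)
open import Relation.Binary.PropositionalEquality hiding ([_])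
open import Relation.Nullary using (¬_; yes; no; contradiction)
open import Relation.Nullary.Decidable using (decidable-stable)

private variable
  n k : ℕ
  p q r : Subset n
  x y : Fin n

lookup-ext : ∀ {A : Set} (xs ys : Vec A n) → (∀ i → lookup xs i ≡ lookup ys i) → xs ≡ ys
lookup-ext xs ys eq = begin
  xs                    ≡⟨ tabulate∘lookup xs ⟨
  tabulate (lookup xs)  ≡⟨ tabulate-cong eq ⟩
  tabulate (lookup ys)  ≡⟨ tabulate∘lookup ys ⟩
  ys                    ∎
  where open ≡-Reasoning

disjoint⇒∩≡⊥ : (∀ {x} → x ∈ p → x ∉ q) → p ∩ q ≡ ⊥
disjoint⇒∩≡⊥ {p = p} {q} disjoint =
  Empty-unique λ (x , x∈p∩q) → let (x∈p , x∈q) = x∈p∩q⁻ p q x∈p∩q in disjoint x∈p x∈q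

∩≡⊥⇒disjoint : p ∩ q ≡ ⊥ → x ∈ p → x ∉ q
∩≡⊥⇒disjoint p∩q≡⊥ x∈p x∈q = ∉⊥ (subst (_ ∈_) p∩q≡⊥ (x∈p∩q⁺ (x∈p , x∈q)))

∣p∪q∣≡∣p∣+∣q∣ : (∀ {x} → x ∈ p → x ∉ q) → ∣ p ∪ q ∣ ≡ ∣ p ∣ + ∣ q ∣
∣p∪q∣≡∣p∣+∣q∣ {p = []}        {[]}        _        = refl
∣p∪q∣≡∣p∣+∣q∣ {p = true ∷ _}  {true ∷ _}  disjoint = contradiction here (disjoint here)
∣p∪q∣≡∣p∣+∣q∣ {p = true ∷ _}  {false ∷ _} disjoint =
  cong suc (∣p∪q∣≡∣p∣+∣q∣ (λ x∈p → disjoint (there x∈p) ∘ there))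
∣p∪q∣≡∣p∣+∣q∣ {p = false ∷ p} {true ∷ q}  disjoint =
  trans (cong suc (∣p∪q∣≡∣p∣+∣q∣ (λ x∈p → disjoint (there x∈p) ∘ there))) (sym (+-suc ∣ p ∣ ∣ q ∣))
∣p∪q∣≡∣p∣+∣q∣ {p = false ∷ _} {false ∷ _} disjoint = ∣p∪q∣≡∣p∣+∣q∣ (λ x∈p → disjoint (there x∈p) ∘ there)

∣p∪⁅x⁆∣≡∣p∣+1 : x ∉ p → ∣ p ∪ ⁅ x ⁆ ∣ ≡ ∣ p ∣ + 1
∣p∪⁅x⁆∣≡∣p∣+1 {x = x} {p} x∉p = begin
  ∣ p ∪ ⁅ x ⁆ ∣      ≡⟨ ∣p∪q∣≡∣p∣+∣q∣ (λ y∈p y∈⁅x⁆ → x∉p (subst (_∈ p) (x∈⁅y⁆⇒x≡y x y∈⁅x⁆) y∈p)) ⟩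
  ∣ p ∣ + ∣ ⁅ x ⁆ ∣  ≡⟨ cong (∣ p ∣ +_) (∣⁅x⁆∣≡1 x) ⟩
  ∣ p ∣ + 1          ∎
  where open ≡-Reasoning

∣p++q∣≡∣p∣+∣q∣ : ∀ {m} (p : Subset m) (q : Subset n) → ∣ p ++ q ∣ ≡ ∣ p ∣ + ∣ q ∣
∣p++q∣≡∣p∣+∣q∣ []          q = refl
∣p++q∣≡∣p∣+∣q∣ (true  ∷ p) q = cong suc (∣p++q∣≡∣p∣+∣q∣ p q)
∣p++q∣≡∣p∣+∣q∣ (false ∷ p) q = ∣p++q∣≡∣p∣+∣q∣ p q

p⊆q∧∣q∣≤∣p∣⇒p≡q : p ⊆ q → ∣ q ∣ ≤ ∣ p ∣ → p ≡ q
p⊆q∧∣q∣≤∣p∣⇒p≡q {p = []}        {[]}        _   _           = refl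
p⊆q∧∣q∣≤∣p∣⇒p≡q {p = true ∷ _}  {true ∷ _}  p⊆q (s≤s ∣q∣≤∣p∣) =
  cong (true ∷_) (p⊆q∧∣q∣≤∣p∣⇒p≡q (drop-∷-⊆ p⊆q) ∣q∣≤∣p∣)
p⊆q∧∣q∣≤∣p∣⇒p≡q {p = true ∷ _}  {false ∷ _} p⊆q _           with () ← p⊆q here
p⊆q∧∣q∣≤∣p∣⇒p≡q {p = false ∷ _} {true ∷ _}  p⊆q ∣q∣≤∣p∣      =
  contradiction ∣q∣≤∣p∣ (<⇒≱ (s≤s (p⊆q⇒∣p∣≤∣q∣ (drop-∷-⊆ p⊆q))))
p⊆q∧∣q∣≤∣p∣⇒p≡q {p = false ∷ _} {false ∷ _} p⊆q ∣q∣≤∣p∣      =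
  cong (false ∷_) (p⊆q∧∣q∣≤∣p∣⇒p≡q (drop-∷-⊆ p⊆q) ∣q∣≤∣p∣)

0<∣p∣⇒nonempty : 0 < ∣ p ∣ → Nonempty p
0<∣p∣⇒nonempty {n} {p} 0<∣p∣ with nonempty? p
... | yes nonempty = nonempty
... | no empty     = contradiction (subst (λ s → 0 < ∣ s ∣) (Empty-unique empty) 0<∣p∣) (<-irrefl (sym (∣⊥∣≡0 n)))

∣p∣≡1⇒unique : ∣ p ∣ ≡ 1 → x ∈ p → y ∈ p → x ≡ y
∣p∣≡1⇒unique {n} {p} {x} {y} ∣p∣≡1 x∈p y∈p = decidable-stable (x ≟ᶠ y) λ x≢y →
  <⇒≱ (subst (∣ p - x ∣ <_) ∣p∣≡1 (x∈p⇒∣p-x∣<∣p∣ x∈p))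
      (subst (_< ∣ p - x ∣) (∣⊥∣≡0 n) (p⊂q⇒∣p∣<∣q∣ (⊥⊆ , y , x∈p∧x≢y⇒x∈p-y y∈p (x≢y ∘ sym) , ∉⊥)))

x∈p─q⇒x∉q : x ∈ p ─ q → x ∉ q
x∈p─q⇒x∉q {p = _ ∷ _} {true  ∷ _} (there x∈p─q) (there x∈q) = x∈p─q⇒x∉q x∈p─q x∈q
x∈p─q⇒x∉q {p = _ ∷ _} {false ∷ _} (there x∈p─q) (there x∈q) = x∈p─q⇒x∉q x∈p─q x∈q

x∉p∧x∉q⇒x∈∁[p∪q] : x ∉ p → x ∉ q → x ∈ ∁ (p ∪ q)
x∉p∧x∉q⇒x∈∁[p∪q] {p = p} {q} x∉p x∉q = x∉p⇒x∈∁p λ x∈p∪q → [ x∉p , x∉q ]′ (x∈p∪q⁻ p q x∈p∪q)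

⊆⊎∃∈∖ : (p q : Subset n) → p ⊆ q ⊎ ∃ λ x → x ∈ p × x ∉ q
⊆⊎∃∈∖ p q with nonempty? (p ─ q)
... | yes (x , x∈p─q) = inj₂ (x , p─q⊆p p q x∈p─q , x∈p─q⇒x∉q x∈p─q)
... | no empty        = inj₁ λ {x} x∈p → decidable-stable (x ∈? q) λ x∉q → empty (x , x∈p∧x∉q⇒x∈p─q x∈p x∉q)

∣p∣≡∣q∣⇒∃∈∖ : ∣ p ∣ ≡ ∣ q ∣ → x ∈ p → x ∉ q → ∃ λ y → y ∈ q × y ∉ p
∣p∣≡∣q∣⇒∃∈∖ {p = p} {q} {x} ∣p∣≡∣q∣ x∈p x∉q with ⊆⊎∃∈∖ q p
... | inj₂ witness = witness
... | inj₁ q⊆p     = contradiction (subst (x ∈_) (sym (p⊆q∧∣q∣≤∣p∣⇒p≡q q⊆p (≤-reflexive ∣p∣≡∣q∣))) x∈p) x∉q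

∃⊆-of-size : ∀ {m} (q : Subset n) → m ≤ ∣ q ∣ → ∃ λ p → p ⊆ q × ∣ p ∣ ≡ m
∃⊆-of-size {n} {zero}  q           _         = ⊥ , ⊥⊆ , ∣⊥∣≡0 n
∃⊆-of-size {m = suc m} (true ∷ q)  (s≤s m≤q) with ∃⊆-of-size q m≤q
... | p , p⊆q , ∣p∣≡m = true ∷ p , s⊆s p⊆q , cong suc ∣p∣≡m
∃⊆-of-size {m = suc m} (false ∷ q) m≤q       with ∃⊆-of-size q m≤q
... | p , p⊆q , ∣p∣≡m = false ∷ p , s⊆s p⊆q , ∣p∣≡m

lookup≡false⇒∉ : lookup p x ≡ false → x ∉ p
lookup≡false⇒∉ eq x∈p with () ← trans (sym ([]=⇒lookup x∈p)) eq

∉⇔∉⇒lookup≡ : (x ∉ p → y ∉ p) → (y ∉ p → x ∉ p) → lookup p x ≡ lookup p y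
∉⇔∉⇒lookup≡ {x = x} {p} {y} x∉⇒y∉ y∉⇒x∉ with lookup p x in px | lookup p y in py
... | true  | true  = refl
... | false | false = refl
... | true  | false = contradiction (lookup⇒[]= x p px) (y∉⇒x∉ (lookup≡false⇒∉ py))
... | false | true  = contradiction (lookup⇒[]= y p py) (x∉⇒y∉ (lookup≡false⇒∉ px))

-- Relabelling the points by a permutation

[_] : Bool → ℕ
[ b ] = if b then 1 else 0

∣p∣≡∑ : ∀ (p : Subset n) → ∣ p ∣ ≡ ∑[ i < n ] [ lookup p i ]
∣p∣≡∑ []          = refl
∣p∣≡∑ (true  ∷ p) = cong suc (∣p∣≡∑ p)
∣p∣≡∑ (false ∷ p) = ∣p∣≡∑ p

infixr 8 _·_

_·_ : Permutation′ n → Subset n → Subset n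
π · p = tabulate (lookup p ∘ (π ⟨$⟩ˡ_))

lookup-· : ∀ (π : Permutation′ n) p i → lookup (π · p) i ≡ lookup p (π ⟨$⟩ˡ i)
lookup-· π p = lookup∘tabulate _

module _ (π : Permutation′ n) where

  ∈-·⁻ : x ∈ π · p → π ⟨$⟩ˡ x ∈ p
  ∈-·⁻ {x} {p} x∈π·p = lookup⇒[]= _ p (trans (sym (lookup-· π p x)) ([]=⇒lookup x∈π·p))

  ∈-·⁺ : π ⟨$⟩ˡ x ∈ p → x ∈ π · p
  ∈-·⁺ {x} {p} πx∈p = lookup⇒[]= x (π · p) (trans (lookup-· π p x) ([]=⇒lookup πx∈p))

  flip-·-· : ∀ p → Perm.flip π · π · p ≡ p
  flip-·-· p = lookup-ext _ _ λ i →
    trans (lookup-· (Perm.flip π) (π · p) i) (trans (lookup-· π p _) (cong (lookup p) (inverseˡ π)))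

  ·-flip-· : ∀ p → π · Perm.flip π · p ≡ p
  ·-flip-· p = lookup-ext _ _ λ i →
    trans (lookup-· π (Perm.flip π · p) i) (trans (lookup-· (Perm.flip π) p _) (cong (lookup p) (inverseʳ π)))

  ∣π·p∣≡∣p∣ : ∀ p → ∣ π · p ∣ ≡ ∣ p ∣
  ∣π·p∣≡∣p∣ p = begin
    ∣ π · p ∣                           ≡⟨ ∣p∣≡∑ (π · p) ⟩
    ∑[ i < n ] [ lookup (π · p) i ]     ≡⟨ sum-cong-≗ (cong [_] ∘ lookup-· π p) ⟩
    ∑[ i < n ] [ lookup p (π ⟨$⟩ˡ i) ]  ≡⟨ ∑-permute ([_] ∘ lookup p) (Perm.flip π) ⟨
    ∑[ i < n ] [ lookup p i ]           ≡⟨ ∣p∣≡∑ p ⟨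
    ∣ p ∣                               ∎
    where open ≡-Reasoning

  ·-preserves-∩≡⊥ : p ∩ q ≡ ⊥ → π · p ∩ π · q ≡ ⊥
  ·-preserves-∩≡⊥ p∩q≡⊥ = disjoint⇒∩≡⊥ λ x∈π·p x∈π·q → ∩≡⊥⇒disjoint p∩q≡⊥ (∈-·⁻ x∈π·p) (∈-·⁻ x∈π·q)

x≡a⊎x≡b⊎x≢a∧x≢b : (x a b : Fin n) → x ≡ a ⊎ x ≡ b ⊎ (x ≢ a × x ≢ b)
x≡a⊎x≡b⊎x≢a∧x≢b x a b with x ≟ᶠ a | x ≟ᶠ b
... | yes x≡a | _       = inj₁ x≡a
... | no _    | yes x≡b = inj₂ (inj₁ x≡b)
... | no x≢a  | no x≢b  = inj₂ (inj₂ (x≢a , x≢b))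

module _ (a b : Fin n) where

  transpose-a : transpose a b ⟨$⟩ˡ a ≡ b
  transpose-a with a ≟ᶠ b
  ... | yes a≡b = a≡b
  ... | no _ with a ≟ᶠ a
  ...   | yes _  = refl
  ...   | no a≢a = contradiction refl a≢a

  transpose-b : transpose a b ⟨$⟩ˡ b ≡ a
  transpose-b with b ≟ᶠ b
  ... | yes _  = refl
  ... | no b≢b = contradiction refl b≢b

  transpose-other : x ≢ a → x ≢ b → transpose a b ⟨$⟩ˡ x ≡ x
  transpose-other {x} x≢a x≢b with x ≟ᶠ b
  ... | yes x≡b = contradiction x≡b x≢b
  ... | no _ with x ≟ᶠ a
  ...   | yes x≡a = contradiction x≡a x≢a
  ...   | no _    = refl

  transpose-fixes : lookup p a ≡ lookup p b → transpose a b · p ≡ p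
  transpose-fixes {p} pa≡pb = lookup-ext _ _ λ x → trans (lookup-· (transpose a b) p x) (fixes x)
    where
    fixes : ∀ x → lookup p (transpose a b ⟨$⟩ˡ x) ≡ lookup p x
    fixes x with x≡a⊎x≡b⊎x≢a∧x≢b x a b
    ... | inj₁ refl               = trans (cong (lookup p) transpose-a) (sym pa≡pb)
    ... | inj₂ (inj₁ refl)        = trans (cong (lookup p) transpose-b) pa≡pb
    ... | inj₂ (inj₂ (x≢a , x≢b)) = cong (lookup p) (transpose-other x≢a x≢b)

  ∈-transpose⁻ : x ∈ transpose a b · p → x ∈ p ⊎ x ≡ a ⊎ x ≡ b
  ∈-transpose⁻ {x} x∈τp with x≡a⊎x≡b⊎x≢a∧x≢b x a b
  ... | inj₁ x≡a                = inj₂ (inj₁ x≡a)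
  ... | inj₂ (inj₁ x≡b)         = inj₂ (inj₂ x≡b)
  ... | inj₂ (inj₂ (x≢a , x≢b)) = inj₁ (subst (_∈ _) (transpose-other x≢a x≢b) (∈-·⁻ (transpose a b) x∈τp))

  transpose-⊆-∪⁅⁆ : a ∈ p ⊎ a ≡ y → b ∈ p ⊎ b ≡ y → x ∈ transpose a b · p → x ∈ p ⊎ x ≡ y
  transpose-⊆-∪⁅⁆ a∈p⊎a≡y b∈p⊎b≡y x∈τp with ∈-transpose⁻ x∈τp
  ... | inj₁ x∈p         = inj₁ x∈p
  ... | inj₂ (inj₁ refl) = a∈p⊎a≡y
  ... | inj₂ (inj₂ refl) = b∈p⊎b≡y

  transpose-─-⊂ : a ∈ p → a ∉ r → b ∉ p → b ∈ r → transpose a b · p ─ r ⊂ p ─ r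
  transpose-─-⊂ {p} {r} a∈p a∉r b∉p b∈r = ⊆ , a , x∈p∧x∉q⇒x∈p─q a∈p a∉r , a∉
    where
    ⊆ : transpose a b · p ─ r ⊆ p ─ r
    ⊆ x∈ with ∈-transpose⁻ (p─q⊆p _ r x∈)
    ... | inj₁ x∈p         = x∈p∧x∉q⇒x∈p─q x∈p (x∈p─q⇒x∉q x∈)
    ... | inj₂ (inj₁ refl) = x∈p∧x∉q⇒x∈p─q a∈p a∉r
    ... | inj₂ (inj₂ refl) = contradiction b∈r (x∈p─q⇒x∉q x∈)
    a∉ : a ∉ transpose a b · p ─ r
    a∉ a∈ = b∉p (subst (_∈ p) transpose-a (∈-·⁻ (transpose a b) (p─q⊆p _ r a∈)))

-- Binary codes

funToFin-cong : ∀ {m} {f g : Fin m → Fin n} → (∀ i → f i ≡ g i) → funToFin f ≡ funToFin g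
funToFin-cong {m = zero}  _  = refl
funToFin-cong {m = suc m} eq = cong₂ combine (eq zero) (funToFin-cong (eq ∘ suc))

funToFin-injective : ∀ {m} {f g : Fin m → Fin n} → funToFin f ≡ funToFin g → ∀ i → f i ≡ g i
funToFin-injective {f = f} {g} eq i = begin
  f i                      ≡⟨ finToFun-funToFin f i ⟨
  finToFun (funToFin f) i  ≡⟨ cong (λ c → finToFun c i) eq ⟩
  finToFun (funToFin g) i  ≡⟨ finToFun-funToFin g i ⟩
  g i                      ∎
  where open ≡-Reasoning

finToFun-injective : ∀ {m} {c c' : Fin (n ^ m)} → (∀ i → finToFun {n} {m} c i ≡ finToFun c' i) → c ≡ c'
finToFun-injective {n} {m} {c} {c'} eq = begin
  c                               ≡⟨ funToFin-finToFin {m} {n} c ⟨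
  funToFin (finToFun {n} {m} c)   ≡⟨ funToFin-cong eq ⟩
  funToFin (finToFun {n} {m} c')  ≡⟨ funToFin-finToFin {m} {n} c' ⟩
  c'                              ∎
  where open ≡-Reasoning

toℕ-funToFin-zeros : ∀ m → toℕ (funToFin {m} {suc n} λ _ → zero) ≡ 0
toℕ-funToFin-zeros zero    = refl
toℕ-funToFin-zeros (suc m) = trans (toℕ-↑ˡ _ _) (toℕ-funToFin-zeros m)

module _ {G : Graph} (φ : Automorphism G) where
  open Automorphism φ

  to-injective : ∀ {u v} → to u ≡ to v → u ≡ v
  to-injective = Injection.injective (Inverse⇒Injection bij)

  inverse : Automorphism G
  inverse = record
    { bij      = ↔-sym bij
    ; preserve = λ u v → mk⇔
        (λ u~v → Equivalence.from (preserve _ _) (subst₂ (Adj G) (sym (to∘from u)) (sym (to∘from v)) u~v))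
        (λ u~v → subst₂ (Adj G) (to∘from u) (to∘from v) (Equivalence.to (preserve _ _) u~v))
    }
    where
    to∘from = Inverse.strictlyInverseˡ bij

vertex-≡ : {A B : KneserV n k} → proj₁ A ≡ proj₁ B → A ≡ B
vertex-≡ {A = p , _} refl = cong (p ,_) (≡-irrelevant _ _)

vertex-⊆⇒≡ : {A B : KneserV n k} → proj₁ A ⊆ proj₁ B → A ≡ B
vertex-⊆⇒≡ {A = A} {B} A⊆B = vertex-≡ (p⊆q∧∣q∣≤∣p∣⇒p≡q A⊆B (≤-reflexive (trans (proj₂ B) (sym (proj₂ A)))))

infixr 8 _⊙_

_⊙_ : Permutation′ n → KneserV n k → KneserV n k
π ⊙ (p , ∣p∣≡k) = π · p , trans (∣π·p∣≡∣p∣ π p) ∣p∣≡k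

relabel : Permutation′ n → Automorphism (Kneser n k)
relabel π = record
  { bij      = mk↔ₛ′ (π ⊙_) (Perm.flip π ⊙_) (λ _ → vertex-≡ (·-flip-· π _)) (λ _ → vertex-≡ (flip-·-· π _))
  ; preserve = λ _ _ → mk⇔ (·-preserves-∩≡⊥ π) λ πA~πB →
      subst₂ (λ p q → p ∩ q ≡ ⊥) (flip-·-· π _) (flip-·-· π _) (·-preserves-∩≡⊥ (Perm.flip π) πA~πB)
  }

-- The odd Kneser graph K(2k+1,k)

module OddKneser (k : ℕ) where

  N : ℕ
  N = 2 * k + 1

  N≡1+k+k : N ≡ suc (k + k)
  N≡1+k+k = trans (+-comm (2 * k) 1) (cong (λ m → suc (k + m)) (+-identityʳ k))

  Vertex : Set
  Vertex = KneserV N k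

  ⌊_⌋ : Vertex → Subset N
  ⌊_⌋ = proj₁

  private variable
    A B A' B' C D P Q P' Q' X Y : Vertex
    a b i j : Fin N

  -- Adjacency in membership form; as a record it keeps both endpoints inferable.
  infix 4 _~_
  record _~_ (A B : Vertex) : Set where
    constructor disjoint
    field ~⇒∉ : i ∈ ⌊ A ⌋ → i ∉ ⌊ B ⌋
  open _~_ public

  ~-sym : A ~ B → B ~ A
  ~-sym A~B = disjoint λ i∈B i∈A → ~⇒∉ A~B i∈A i∈B

  automorphism-~ : (φ : Automorphism (Kneser N k)) → A ~ B → Automorphism.to φ A ~ Automorphism.to φ B
  automorphism-~ φ A~B =
    disjoint (∩≡⊥⇒disjoint (Equivalence.to (Automorphism.preserve φ _ _) (disjoint⇒∩≡⊥ (~⇒∉ A~B))))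

  Misses : Vertex → Vertex → Fin N → Set
  Misses A B i = A ~ B × i ∉ ⌊ A ⌋ × i ∉ ⌊ B ⌋

  misses-sym : Misses A B i → Misses B A i
  misses-sym (A~B , i∉A , i∉B) = ~-sym A~B , i∉B , i∉A

  ∣∁[A∪B]∣≡1 : A ~ B → ∣ ∁ (⌊ A ⌋ ∪ ⌊ B ⌋) ∣ ≡ 1
  ∣∁[A∪B]∣≡1 {A} {B} A~B = begin
    ∣ ∁ (⌊ A ⌋ ∪ ⌊ B ⌋) ∣        ≡⟨ ∣∁p∣≡n∸∣p∣ (⌊ A ⌋ ∪ ⌊ B ⌋) ⟩
    N ∸ ∣ ⌊ A ⌋ ∪ ⌊ B ⌋ ∣        ≡⟨ cong (N ∸_) (∣p∪q∣≡∣p∣+∣q∣ (~⇒∉ A~B)) ⟩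
    N ∸ (∣ ⌊ A ⌋ ∣ + ∣ ⌊ B ⌋ ∣)  ≡⟨ cong₂ (λ a b → N ∸ (a + b)) (proj₂ A) (proj₂ B) ⟩
    N ∸ (k + k)                  ≡⟨ cong (_∸ (k + k)) N≡1+k+k ⟩
    suc (k + k) ∸ (k + k)        ≡⟨ m+n∸n≡m 1 (k + k) ⟩
    1                            ∎
    where open ≡-Reasoning

  hole-unique : A ~ B → i ∉ ⌊ A ⌋ → i ∉ ⌊ B ⌋ → j ∉ ⌊ A ⌋ → j ∉ ⌊ B ⌋ → i ≡ j
  hole-unique {A} {B} A~B i∉A i∉B j∉A j∉B =
    ∣p∣≡1⇒unique (∣∁[A∪B]∣≡1 {A} {B} A~B) (x∉p∧x∉q⇒x∈∁[p∪q] i∉A i∉B) (x∉p∧x∉q⇒x∈∁[p∪q] j∉A j∉B)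

  hole-exists : A ~ B → ∃ (Misses A B)
  hole-exists {A} {B} A~B with 0<∣p∣⇒nonempty (subst (0 <_) (sym (∣∁[A∪B]∣≡1 {A} {B} A~B)) z<s)
  ... | i , i∈∁ = i , A~B , (x∈∁p⇒x∉p i∈∁ ∘ p⊆p∪q ⌊ B ⌋) , (x∈∁p⇒x∉p i∈∁ ∘ q⊆p∪q ⌊ A ⌋ ⌊ B ⌋)

  ∉⇒∈⊎≡hole : Misses A B i → j ∉ ⌊ A ⌋ → j ∈ ⌊ B ⌋ ⊎ j ≡ i
  ∉⇒∈⊎≡hole {B = B} {j = j} (A~B , i∉A , i∉B) j∉A with j ∈? ⌊ B ⌋
  ... | yes j∈B = inj₁ j∈B
  ... | no j∉B  = inj₂ (hole-unique A~B j∉A j∉B i∉A i∉B)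

  misses-functional : Misses A B i → Misses A B' i → B ≡ B'
  misses-functional (A~B , _ , i∉B) m = vertex-⊆⇒≡ λ j∈B →
    [ id , (λ { refl → contradiction j∈B i∉B }) ]′ (∉⇒∈⊎≡hole m (~⇒∉ (~-sym A~B) j∈B))

  partner : (A : Vertex) (i : Fin N) → i ∉ ⌊ A ⌋ → Vertex
  partner A i i∉A = ∁ (⌊ A ⌋ ∪ ⁅ i ⁆) , (begin
    ∣ ∁ (⌊ A ⌋ ∪ ⁅ i ⁆) ∣  ≡⟨ ∣∁p∣≡n∸∣p∣ (⌊ A ⌋ ∪ ⁅ i ⁆) ⟩
    N ∸ ∣ ⌊ A ⌋ ∪ ⁅ i ⁆ ∣  ≡⟨ cong (N ∸_) (∣p∪⁅x⁆∣≡∣p∣+1 i∉A) ⟩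
    N ∸ (∣ ⌊ A ⌋ ∣ + 1)    ≡⟨ cong (λ a → N ∸ (a + 1)) (proj₂ A) ⟩
    N ∸ (k + 1)           ≡⟨ cong₂ _∸_ N≡1+k+k (+-comm k 1) ⟩
    suc (k + k) ∸ suc k   ≡⟨ m+n∸m≡n k k ⟩
    k                     ∎)
    where open ≡-Reasoning

  ∈-partner⁺ : ∀ A (i∉A : i ∉ ⌊ A ⌋) → j ∉ ⌊ A ⌋ → j ≢ i → j ∈ ⌊ partner A i i∉A ⌋
  ∈-partner⁺ _ _ j∉A j≢i = x∉p∧x∉q⇒x∈∁[p∪q] j∉A (x≢y⇒x∉⁅y⁆ j≢i)

  ∈-partner⁻ : ∀ A (i∉A : i ∉ ⌊ A ⌋) → j ∈ ⌊ partner A i i∉A ⌋ → j ∉ ⌊ A ⌋ × j ≢ i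
  ∈-partner⁻ {i} A _ j∈ = x∈∁p⇒x∉p j∈ ∘ p⊆p∪q ⁅ i ⁆ , λ { refl → x∈∁p⇒x∉p j∈ (q⊆p∪q ⌊ A ⌋ ⁅ i ⁆ (x∈⁅x⁆ i)) }

  partner-misses : ∀ A (i∉A : i ∉ ⌊ A ⌋) → Misses A (partner A i i∉A) i
  partner-misses A i∉A =
    disjoint (λ j∈A j∈P → proj₁ (∈-partner⁻ A i∉A j∈P) j∈A) , i∉A , λ i∈P → proj₂ (∈-partner⁻ A i∉A i∈P) refl

  partner-~ : ∀ C (i∉C : i ∉ ⌊ C ⌋) → (∀ {j} → j ∈ ⌊ D ⌋ → j ∈ ⌊ C ⌋ ⊎ j ≡ i) → partner C i i∉C ~ D
  partner-~ C i∉C D⊆C∪⁅i⁆ = disjoint λ j∈P j∈D →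
    let (j∉C , j≢i) = ∈-partner⁻ C i∉C j∈P in [ j∉C , j≢i ]′ (D⊆C∪⁅i⁆ j∈D)

  hole∈neighbour : Misses P Q i → X ~ P → X ≢ Q → i ∈ ⌊ X ⌋
  hole∈neighbour {i = i} {X} m X~P X≢Q = decidable-stable (i ∈? ⌊ X ⌋) λ i∉X →
    X≢Q (vertex-⊆⇒≡ λ j∈X → [ id , (λ { refl → contradiction j∈X i∉X }) ]′ (∉⇒∈⊎≡hole m (~⇒∉ X~P j∈X)))

  misses-transfer : Misses P Q i → P' ~ Q' →
                    X ~ P → X ~ P' → X ≢ Q' → Y ~ Q → Y ~ Q' → Y ≢ P' → Misses P' Q' i
  misses-transfer (P~Q , i∉P , i∉Q) P'~Q' X~P X~P' X≢Q' Y~Q Y~Q' Y≢P' with hole-exists P'~Q'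
  ... | j , m = subst (Misses _ _) (hole-unique P~Q j∉P j∉Q i∉P i∉Q) m
    where
    j∉P = ~⇒∉ X~P (hole∈neighbour m X~P' X≢Q')
    j∉Q = ~⇒∉ Y~Q (hole∈neighbour (misses-sym m) Y~Q' Y≢P')

  exchange-misses : Misses A B i → a ∈ ⌊ A ⌋ → b ∈ ⌊ B ⌋ → Misses (transpose a b ⊙ A) (transpose a b ⊙ B) i
  exchange-misses {A} {B} {i} {a} {b} m@(A~B , i∉A , i∉B) a∈A b∈B =
    automorphism-~ (relabel τ) A~B , τi∉A ∘ ∈-·⁻ τ , τi∉B ∘ ∈-·⁻ τ
    where
    τ = transpose a b
    τi≡i : τ ⟨$⟩ˡ i ≡ i
    τi≡i = transpose-other a b (λ { refl → i∉A a∈A }) (λ { refl → i∉B b∈B })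
    τi∉A = subst (_∉ ⌊ A ⌋) (sym τi≡i) i∉A
    τi∉B = subst (_∉ ⌊ B ⌋) (sym τi≡i) i∉B

  module HoleInvariance (φ : Automorphism (Kneser N k)) where
    open Automorphism φ using (to)

    -- X = partner A b and Y = partner B a witness misses-transfer for the exchanged edge.
    exchange : Misses A B i → a ∈ ⌊ A ⌋ → b ∈ ⌊ B ⌋ → Misses (to A) (to B) j →
               Misses (to (transpose a b ⊙ A)) (to (transpose a b ⊙ B)) j
    exchange {A} {B} {i} {a} {b} m@(A~B , _ , _) a∈A b∈B φm =
      misses-transfer φm (to-~ (proj₁ (exchange-misses m a∈A b∈B)))
        (to-~ X~A) (to-~ X~τA) (X≢τB ∘ to-injective φ) (to-~ Y~B) (to-~ Y~τB) (Y≢τA ∘ to-injective φ)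
      where
      to-~ : C ~ D → to C ~ to D
      to-~ = automorphism-~ φ
      τ = transpose a b
      b∉A = ~⇒∉ (~-sym A~B) b∈B
      a∉B = ~⇒∉ A~B a∈A
      X~A : partner A b b∉A ~ A
      X~A = ~-sym (proj₁ (partner-misses A b∉A))
      Y~B : partner B a a∉B ~ B
      Y~B = ~-sym (proj₁ (partner-misses B a∉B))
      X~τA : partner A b b∉A ~ τ ⊙ A
      X~τA = partner-~ A b∉A (transpose-⊆-∪⁅⁆ a b (inj₁ a∈A) (inj₂ refl))
      Y~τB : partner B a a∉B ~ τ ⊙ B
      Y~τB = partner-~ B a∉B (transpose-⊆-∪⁅⁆ a b (inj₂ refl) (inj₁ b∈B))
      a∈τB : a ∈ ⌊ τ ⊙ B ⌋
      a∈τB = ∈-·⁺ τ (subst (_∈ ⌊ B ⌋) (sym (transpose-a a b)) b∈B)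
      b∈τA : b ∈ ⌊ τ ⊙ A ⌋
      b∈τA = ∈-·⁺ τ (subst (_∈ ⌊ A ⌋) (sym (transpose-b a b)) a∈A)
      X≢τB : partner A b b∉A ≢ τ ⊙ B
      X≢τB X≡τB = proj₁ (∈-partner⁻ A b∉A (subst (λ C → a ∈ ⌊ C ⌋) (sym X≡τB) a∈τB)) a∈A
      Y≢τA : partner B a a∉B ≢ τ ⊙ A
      Y≢τA Y≡τA = proj₁ (∈-partner⁻ B a∉B (subst (λ C → b ∈ ⌊ C ⌋) (sym Y≡τA) b∈τA)) b∈B

    -- Well-founded induction on C ─ A': exchanging a ∈ C ─ A' with b ∈ A' ─ C shrinks it.
    hole-invariant : Misses A B i → Misses A' B' i → Misses (to A) (to B) j → Misses (to A') (to B') j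
    hole-invariant {A} {B} {i} {A'} {B'} {j} m m' = go (⊂-wellFounded (⌊ A ⌋ ─ ⌊ A' ⌋)) m
      where
      go : Acc _⊂_ (⌊ C ⌋ ─ ⌊ A' ⌋) → Misses C D i → Misses (to C) (to D) j → Misses (to A') (to B') j
      go {C} {D} (acc smaller) m φm with ⊆⊎∃∈∖ ⌊ C ⌋ ⌊ A' ⌋
      ... | inj₁ C⊆A' with refl ← vertex-⊆⇒≡ {A = C} {A'} C⊆A' =
        subst (λ E → Misses (to C) (to E) j) (misses-functional m m') φm
      ... | inj₂ (a , a∈C , a∉A') with ∣p∣≡∣q∣⇒∃∈∖ (trans (proj₂ C) (sym (proj₂ A'))) a∈C a∉A'
      ...   | b , b∈A' , b∉C =
        go (smaller (transpose-─-⊂ a b a∈C a∉A' b∉C b∈A')) (exchange-misses m a∈C b∈D) (exchange m a∈C b∈D φm)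
        where
        b∈D : b ∈ ⌊ D ⌋
        b∈D = [ id , (λ { refl → contradiction b∈A' (proj₁ (proj₂ m')) }) ]′ (∉⇒∈⊎≡hole m b∉C)

    hole-avoids-fixed : to C ≡ C → Misses A B i → Misses (to A) (to B) j → i ∉ ⌊ C ⌋ → j ∉ ⌊ C ⌋
    hole-avoids-fixed {C} {i = i} {j} φC≡C m φm i∉C = proj₁ (proj₂ φm′)
      where
      φm′ : Misses C (to (partner C i i∉C)) j
      φm′ = subst (λ E → Misses E (to (partner C i i∉C)) j) φC≡C (hole-invariant m (partner-misses C i∉C) φm)

  Distinguishing : List Vertex → Set
  Distinguishing S = ∀ {i j} → (∀ {v} → v ∈ₗ S → lookup ⌊ v ⌋ i ≡ lookup ⌊ v ⌋ j) → i ≡ j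

  distinguishing⇒determining : (S : List Vertex) → Distinguishing S → IsDetermining (Kneser N k) S
  distinguishing⇒determining S distinguishing φ φ-fixes A = vertex-⊆⇒≡ φA⊆A
    where
    open Automorphism φ using (to; bij)
    open HoleInvariance using (hole-avoids-fixed)
    from∘to = Inverse.strictlyInverseʳ bij
    φ⁻¹-fixes : ∀ {v} → v ∈ₗ S → Automorphism.to (inverse φ) v ≡ v
    φ⁻¹-fixes {v} v∈S = trans (cong (Inverse.from bij) (sym (φ-fixes v v∈S))) (from∘to v)
    φA⊆A : ⌊ to A ⌋ ⊆ ⌊ A ⌋
    φA⊆A {i} i∈φA = decidable-stable (i ∈? ⌊ A ⌋) λ i∉A →
      let m          = partner-misses A i∉A
          (j , φm)   = hole-exists (automorphism-~ φ (proj₁ m))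
          φ⁻¹φm      = subst₂ (λ C D → Misses C D i) (sym (from∘to _)) (sym (from∘to _)) m
          i≡j        = distinguishing λ v∈S → ∉⇔∉⇒lookup≡ (hole-avoids-fixed φ (φ-fixes _ v∈S) m φm)
                                                         (hole-avoids-fixed (inverse φ) (φ⁻¹-fixes v∈S) φm φ⁻¹φm)
      in proj₁ (proj₂ φm) (subst (_∈ ⌊ to A ⌋) i≡j i∈φA)

  k≤∣∁[⁅a⁆∪⁅b⁆]∣ : 1 ≤ k → a ≢ b → k ≤ ∣ ∁ (⁅ a ⁆ ∪ ⁅ b ⁆) ∣
  k≤∣∁[⁅a⁆∪⁅b⁆]∣ {a} {b} 1≤k a≢b = begin
    k                            ≤⟨ m≤m+n k (k ∸ 1) ⟩
    k + (k ∸ 1)                  ≡⟨ +-∸-assoc k 1≤k ⟨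
    suc (k + k) ∸ 2              ≡⟨ cong (_∸ 2) N≡1+k+k ⟨
    N ∸ 2                        ≡⟨ cong (λ m → N ∸ (m + 1)) (∣⁅x⁆∣≡1 a) ⟨
    N ∸ (∣ ⁅ a ⁆ ∣ + 1)          ≡⟨ cong (N ∸_) (∣p∪⁅x⁆∣≡∣p∣+1 (x≢y⇒x∉⁅y⁆ (a≢b ∘ sym))) ⟨
    N ∸ ∣ ⁅ a ⁆ ∪ ⁅ b ⁆ ∣        ≡⟨ ∣∁p∣≡n∸∣p∣ (⁅ a ⁆ ∪ ⁅ b ⁆) ⟨
    ∣ ∁ (⁅ a ⁆ ∪ ⁅ b ⁆) ∣        ∎
    where open ≤-Reasoning

  avoiding-vertex : 1 ≤ k → a ≢ b → ∃ λ A → a ∉ ⌊ A ⌋ × b ∉ ⌊ A ⌋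
  avoiding-vertex {a} {b} 1≤k a≢b with ∃⊆-of-size (∁ (⁅ a ⁆ ∪ ⁅ b ⁆)) (k≤∣∁[⁅a⁆∪⁅b⁆]∣ 1≤k a≢b)
  ... | p , p⊆∁ab , ∣p∣≡k =
    (p , ∣p∣≡k) , (λ a∈p → x∈∁p⇒x∉p (p⊆∁ab a∈p) (p⊆p∪q ⁅ b ⁆ (x∈⁅x⁆ a)))
                , (λ b∈p → x∈∁p⇒x∉p (p⊆∁ab b∈p) (q⊆p∪q ⁅ a ⁆ ⁅ b ⁆ (x∈⁅x⁆ b)))

  separating-vertex : 1 ≤ k → a ≢ b → ∃ λ A → a ∈ ⌊ A ⌋ × b ∉ ⌊ A ⌋
  separating-vertex 1≤k a≢b with avoiding-vertex 1≤k a≢b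
  ... | A , a∉A , b∉A = partner A _ b∉A , ∈-partner⁺ A b∉A a∉A a≢b , proj₂ (proj₂ (partner-misses A b∉A))

  same-side⇒¬determining : 1 ≤ k → a ≢ b → (S : List Vertex) →
                           (∀ {v} → v ∈ₗ S → lookup ⌊ v ⌋ a ≡ lookup ⌊ v ⌋ b) → ¬ IsDetermining (Kneser N k) S
  same-side⇒¬determining {a} {b} 1≤k a≢b S same determining with separating-vertex 1≤k a≢b
  ... | A , a∈A , b∉A = b∉A (subst (λ C → b ∈ ⌊ C ⌋) τA≡A b∈τA)
    where
    τ = transpose a b
    τA≡A : τ ⊙ A ≡ A
    τA≡A = determining (relabel τ) (λ v v∈S → vertex-≡ (transpose-fixes a b (same v∈S))) A
    b∈τA : b ∈ ⌊ τ ⊙ A ⌋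
    b∈τA = ∈-·⁺ τ (subst (_∈ ⌊ A ⌋) (sym (transpose-b a b)) a∈A)

  determining⇒distinguishing : 1 ≤ k → (S : List Vertex) → IsDetermining (Kneser N k) S → Distinguishing S
  determining⇒distinguishing 1≤k S determining {i} {j} same =
    decidable-stable (i ≟ᶠ j) λ i≢j → same-side⇒¬determining 1≤k i≢j S same determining

  signature : (S : List Vertex) → Fin N → Fin (2 ^ length S)
  signature S i = funToFin λ ι → Inverse.from 2↔Bool (lookup ⌊ List.lookup S ι ⌋ i)

  signature-≡⇒same-side : (S : List Vertex) → signature S i ≡ signature S j →
                          ∀ {v} → v ∈ₗ S → lookup ⌊ v ⌋ i ≡ lookup ⌊ v ⌋ j
  signature-≡⇒same-side {i} {j} S eq v∈S =
    subst (λ v → lookup ⌊ v ⌋ i ≡ lookup ⌊ v ⌋ j) (sym (lookup-index v∈S))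
      (Injection.injective (Inverse⇒Injection (↔-sym 2↔Bool)) (funToFin-injective eq (Any.index v∈S)))

  distinguishing⇒N≤2^∣S∣ : (S : List Vertex) → Distinguishing S → N ≤ 2 ^ length S
  distinguishing⇒N≤2^∣S∣ S distinguishing with N ≤? 2 ^ length S
  ... | yes N≤2^∣S∣ = N≤2^∣S∣
  ... | no N≰2^∣S∣ with pigeonhole (≰⇒> N≰2^∣S∣) (signature S)
  ...   | i , j , i<j , eq = contradiction (cong toℕ (distinguishing (signature-≡⇒same-side S eq))) (<⇒≢ i<j)

  2^ℓ≢N : 1 ≤ k → ∀ ℓ → 2 ^ ℓ ≢ N
  2^ℓ≢N (s≤s _) zero    1≡N       with () ← suc-injective (trans 1≡N N≡1+k+k)
  2^ℓ≢N _       (suc ℓ) 2^[1+ℓ]≡N with () ← ∣1⇒≡1 (∣m+n∣m⇒∣n (subst (2 ∣_) 2^[1+ℓ]≡N (m∣m*n (2 ^ ℓ))) (m∣m*n k))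

  N≤2^ℓ⇒r≤ℓ : 1 ≤ k → ∀ {r ℓ} → 2 ^ (r ∸ 1) ∸ 1 < N → N ≤ 2 ^ ℓ → r ≤ ℓ
  N≤2^ℓ⇒r≤ℓ 1≤k {r} {ℓ} 2^[r∸1]∸1<N N≤2^ℓ with r ≤? ℓ
  ... | yes r≤ℓ = r≤ℓ
  ... | no r≰ℓ  = contradiction (≤-antisym (≤-trans (^-monoʳ-≤ 2 ℓ≤r∸1) 2^[r∸1]≤N) N≤2^ℓ) (2^ℓ≢N 1≤k ℓ)
    where
    ℓ≤r∸1 : ℓ ≤ r ∸ 1
    ℓ≤r∸1 = ∸-monoˡ-≤ 1 (≰⇒> r≰ℓ)
    2^[r∸1]≤N : 2 ^ (r ∸ 1) ≤ N
    2^[r∸1]≤N = subst (_≤ N) (trans (+-comm 1 _) (m∸n+n≡m (m^n>0 2 (r ∸ 1)))) 2^[r∸1]∸1<N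

  N≤2^[1+m]∸1⇒k<2^m : ∀ m → N ≤ 2 ^ suc m ∸ 1 → k < 2 ^ m
  N≤2^[1+m]∸1⇒k<2^m m N≤2^[1+m]∸1 = *-cancelˡ-≤ 2 (begin
    2 * suc k  ≡⟨ *-suc 2 k ⟩
    2 + 2 * k  ≡⟨ +-comm 2 (2 * k) ⟩
    2 * k + 2  ≡⟨ +-assoc (2 * k) 1 1 ⟨
    N + 1      ≤⟨ m≤o∸n⇒m+n≤o N (m^n>0 2 (suc m)) N≤2^[1+m]∸1 ⟩
    2 * 2 ^ m  ∎)
    where open ≤-Reasoning

  -- The points are split as [2k+1] = L ∪ R ∪ {c} with |L| = |R| = k.  The marker vertex is R;
  -- the j-th column contains the i-th point of L iff bit j of i+1 is 1, and the i-th point of R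
  -- iff that bit is 0.  Counting from 1 puts every point of L in some column, while c is in none.
  module Construction {m : ℕ} (k<2^m : k < 2 ^ m) where

    left-point : Fin k → Fin N
    left-point i = (i ↑ˡ (k + 0)) ↑ˡ 1

    right-point : Fin k → Fin N
    right-point i = (k ↑ʳ (i ↑ˡ 0)) ↑ˡ 1

    centre-point : Fin N
    centre-point = (k + (k + 0)) ↑ʳ zero

    data Position : Fin N → Set where
      left   : (i : Fin k) → Position (left-point i)
      right  : (i : Fin k) → Position (right-point i)
      centre : Position centre-point

    position : (x : Fin N) → Position x
    position x with splitAt (k + (k + 0)) x in eq
    ... | inj₂ zero = subst Position (splitAt⁻¹-↑ʳ eq) centre
    ... | inj₁ y with splitAt k y in eq₁
    ...   | inj₁ i = subst Position (trans (cong (_↑ˡ 1) (splitAt⁻¹-↑ˡ eq₁)) (splitAt⁻¹-↑ˡ eq)) (left i)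
    ...   | inj₂ z with splitAt k z in eq₂
    ...     | inj₁ i = subst Position (trans (cong (_↑ˡ 1) z≡) (splitAt⁻¹-↑ˡ eq)) (right i)
      where
      z≡ : k ↑ʳ (i ↑ˡ 0) ≡ y
      z≡ = trans (cong (k ↑ʳ_) (splitAt⁻¹-↑ˡ eq₂)) (splitAt⁻¹-↑ʳ eq₁)

    halves : Vec Bool k → Vertex
    halves c = (c ++ ∁ c ++ []) ++ false ∷ [] , (begin
      ∣ (c ++ ∁ c ++ []) ++ false ∷ [] ∣  ≡⟨ ∣p++q∣≡∣p∣+∣q∣ (c ++ ∁ c ++ []) (false ∷ []) ⟩
      ∣ c ++ ∁ c ++ [] ∣ + 0              ≡⟨ +-identityʳ _ ⟩
      ∣ c ++ ∁ c ++ [] ∣                  ≡⟨ ∣p++q∣≡∣p∣+∣q∣ c (∁ c ++ []) ⟩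
      ∣ c ∣ + ∣ ∁ c ++ [] ∣               ≡⟨ cong (∣ c ∣ +_) (trans (∣p++q∣≡∣p∣+∣q∣ (∁ c) []) (+-identityʳ _)) ⟩
      ∣ c ∣ + ∣ ∁ c ∣                     ≡⟨ cong (∣ c ∣ +_) (∣∁p∣≡n∸∣p∣ c) ⟩
      ∣ c ∣ + (k ∸ ∣ c ∣)                 ≡⟨ m+[n∸m]≡n (∣p∣≤n c) ⟩
      k                                  ∎)
      where open ≡-Reasoning

    lookup-left : ∀ c i → lookup ⌊ halves c ⌋ (left-point i) ≡ lookup c i
    lookup-left c i = trans (lookup-++ˡ (c ++ ∁ c ++ []) (false ∷ []) _) (lookup-++ˡ c (∁ c ++ []) i)

    lookup-right : ∀ c i → lookup ⌊ halves c ⌋ (right-point i) ≡ not (lookup c i)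
    lookup-right c i = begin
      lookup ⌊ halves c ⌋ (right-point i)      ≡⟨ lookup-++ˡ (c ++ ∁ c ++ []) (false ∷ []) _ ⟩
      lookup (c ++ ∁ c ++ []) (k ↑ʳ (i ↑ˡ 0))  ≡⟨ lookup-++ʳ c (∁ c ++ []) _ ⟩
      lookup (∁ c ++ []) (i ↑ˡ 0)              ≡⟨ lookup-++ˡ (∁ c) [] i ⟩
      lookup (∁ c) i                           ≡⟨ lookup-map i not c ⟩
      not (lookup c i)                         ∎
      where open ≡-Reasoning

    lookup-centre : ∀ c → lookup ⌊ halves c ⌋ centre-point ≡ false
    lookup-centre c = lookup-++ʳ (c ++ ∁ c ++ []) (false ∷ []) zero

    code : Fin k → Fin (2 ^ m)
    code i = inject≤ (suc i) k<2^m

    code-injective : ∀ {i i'} → code i ≡ code i' → i ≡ i'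
    code-injective eq = suc-injectiveᶠ (inject≤-injective k<2^m k<2^m _ _ eq)

    bit : Fin (2 ^ m) → Fin m → Bool
    bit c j = Inverse.to 2↔Bool (finToFun {2} {m} c j)

    bit-injective : ∀ {c c'} → (∀ j → bit c j ≡ bit c' j) → c ≡ c'
    bit-injective eq = finToFun-injective (Injection.injective (Inverse⇒Injection 2↔Bool) ∘ eq)

    zeros : Fin (2 ^ m)
    zeros = funToFin {m} {2} λ _ → zero

    bit-zeros : ∀ j → bit zeros j ≡ false
    bit-zeros j = cong (Inverse.to 2↔Bool) (finToFun-funToFin {m} {2} (λ _ → zero) j)

    code≢zeros : ∀ i → code i ≢ zeros
    code≢zeros i eq with () ← trans (sym (toℕ-inject≤ (suc i) k<2^m)) (trans (cong toℕ eq) (toℕ-funToFin-zeros {1} m))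

    column-bits : Fin m → Vec Bool k
    column-bits j = tabulate λ i → bit (code i) j

    column : Fin m → Vertex
    column j = halves (column-bits j)

    marker : Vertex
    marker = halves ⊥

    column-left : ∀ j i → lookup ⌊ column j ⌋ (left-point i) ≡ bit (code i) j
    column-left j i = trans (lookup-left (column-bits j) i) (lookup∘tabulate _ i)

    column-right : ∀ j i → lookup ⌊ column j ⌋ (right-point i) ≡ not (bit (code i) j)
    column-right j i = trans (lookup-right (column-bits j) i) (cong not (lookup∘tabulate _ i))

    marker-left : ∀ i → lookup ⌊ marker ⌋ (left-point i) ≡ false
    marker-left i = trans (lookup-left ⊥ i) (lookup-replicate i false)

    marker-right : ∀ i → lookup ⌊ marker ⌋ (right-point i) ≡ true
    marker-right i = trans (lookup-right ⊥ i) (cong not (lookup-replicate i false))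

    determining-list : List Vertex
    determining-list = marker ∷ List.tabulate column

    length-determining-list : length determining-list ≡ suc m
    length-determining-list = cong suc (length-tabulate column)

    SameSides : Fin N → Fin N → Set
    SameSides x y = lookup ⌊ marker ⌋ x ≡ lookup ⌊ marker ⌋ y × (∀ j → lookup ⌊ column j ⌋ x ≡ lookup ⌊ column j ⌋ y)

    left-centre-differ : ∀ i → ¬ SameSides (left-point i) centre-point
    left-centre-differ i (_ , same-column) = code≢zeros i (bit-injective λ j → begin
      bit (code i) j                      ≡⟨ column-left j i ⟨
      lookup ⌊ column j ⌋ (left-point i)  ≡⟨ same-column j ⟩
      lookup ⌊ column j ⌋ centre-point    ≡⟨ lookup-centre (column-bits j) ⟩
      false                               ≡⟨ bit-zeros j ⟨
      bit zeros j                         ∎)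
      where open ≡-Reasoning

    same-sides⇒≡ : Position x → Position y → SameSides x y → x ≡ y
    same-sides⇒≡ (left i)  (left i')  (_ , same-column) = cong left-point (code-injective (bit-injective λ j →
      trans (sym (column-left j i)) (trans (same-column j) (column-left j i'))))
    same-sides⇒≡ (right i) (right i') (_ , same-column) = cong right-point (code-injective (bit-injective λ j →
      not-injective (trans (sym (column-right j i)) (trans (same-column j) (column-right j i')))))
    same-sides⇒≡ centre    centre     _                 = refl
    same-sides⇒≡ (left i)  centre     same              = contradiction same (left-centre-differ i)
    same-sides⇒≡ centre    (left i)   (same-marker , same-column) =
      contradiction (sym same-marker , sym ∘ same-column) (left-centre-differ i)
    same-sides⇒≡ (left i)  (right i') (same-marker , _) with () ←
      trans (sym (marker-left i)) (trans same-marker (marker-right i'))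
    same-sides⇒≡ (right i) (left i')  (same-marker , _) with () ←
      trans (sym (marker-left i')) (trans (sym same-marker) (marker-right i))
    same-sides⇒≡ (right i) centre     (same-marker , _) with () ←
      trans (sym (lookup-centre ⊥)) (trans (sym same-marker) (marker-right i))
    same-sides⇒≡ centre    (right i)  (same-marker , _) with () ←
      trans (sym (lookup-centre ⊥)) (trans same-marker (marker-right i))

    distinguishing : Distinguishing determining-list
    distinguishing {x} {y} same =
      same-sides⇒≡ (position x) (position y) (same (here refl) , λ j → same (there (∈-tabulate⁺ j)))

mainTheorem6 : (k : ℕ) → 1 ≤ k → (r : ℕ) →
    2 ^ (r ∸ 1) ∸ 1 < 2 * k + 1 → 2 * k + 1 ≤ 2 ^ r ∸ 1 →
    DetEq (Kneser (2 * k + 1) k) r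
mainTheorem6 k 1≤k zero _ N≤0 with () ← subst (_≤ 0) (OddKneser.N≡1+k+k k) N≤0
mainTheorem6 k 1≤k (suc m) 2^m∸1<N N≤2^[1+m]∸1 =
  (determining-list , distinguishing⇒determining determining-list distinguishing , length-determining-list) ,
  λ S S-determining →
    N≤2^ℓ⇒r≤ℓ 1≤k 2^m∸1<N (distinguishing⇒N≤2^∣S∣ S (determining⇒distinguishing 1≤k S S-determining))
  where
  open OddKneser k
  open Construction {m} (N≤2^[1+m]∸1⇒k<2^m m N≤2^[1+m]∸1)
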